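{- Let $(S,A,\to)$ be an image-finite labelled transition system and ${\cal O}\subseteq{\it HML}$. (1) If for every formula $D[\bigwedge_{i\in I}\varphi_i]\in{\cal O}$ (with $D[]$ a context) such that $I$ is infinite and $d(\bigwedge_{i\in I}\varphi_i)=\infty$, we have $D[\bigwedge_{i\in J}\varphi_i]\in{\cal O}$ for all finite $J\subseteq I$, then the relations $\sim_{\cal O}$ and $\sim_{{\cal O}_{\rm FDP}}$ on $S$ coincide. (2) If for every formula $D[\bigwedge_{i\in I}\varphi_i]\in{\cal O}$ (with $D[]$ a context) such that $I$ is infinite, we have $D[\bigwedge_{i\in J}\varphi_i]\in{\cal O}$ for all finite $J\subseteq I$, then the relations $\sim_{\cal O}$ and $\sim_{{\cal O}_{\rm FIN}}$ on $S$ coincide.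
   Context: A labelled transition system consists of a set $S$ of states, a set $A$ of actions and transitions $s\xrightarrow{a}s'$; it is image-finite if for each $s$ and $a$ there are only finitely many transitions $s\xrightarrow{a}s'$. Hennessy-Milner logic ${\it HML}$ has formulas $\varphi ::= {\sf T} \mid \bigwedge_{i\in I}\varphi_i \mid \langle a\rangle\varphi \mid \neg\varphi$ ($a\in A$, $I$ arbitrary index set), with $s\models{\sf T}$; $s\models\bigwedge_{i\in I}\varphi_i$ iff $s\models\varphi_i$ for all $i$; $s\models\langle a\rangle\varphi$ iff some $s'$ with $s\xrightarrow{a}s'$ satisfies $\varphi$; $s\models\neg\varphi$ iff $s\not\models\varphi$. A context $D[]$ is a formula with exactly one occurrence of a hole $[]$ in place of a subformula; $D[\psi]$ replaces the hole by $\psi$. The depth $d:{\it HML}\to\mathbb{N}\cup\{\infty\}$ is defined by $d({\sf T})=0$, $d(\bigwedge_{i\in I}\varphi_i)=\sup\{d(\varphi_i)\mid i\in I\}$, $d(\langle a\rangle\varphi)=1+d(\varphi)$, $d(\neg\varphi)=d(\varphi)$. For ${\cal O}\subseteq{\it HML}$, $s\sim_{\cal O}s'$ means that $s$ and $s'$ satisfy exactly the same formulas of ${\cal O}$; ${\cal O}_{\rm FDP}=\{\varphi\in{\cal O}\mid d(\varphi)<\infty\}$, and ${\cal O}_{\rm FIN}$ is the set of formulas of ${\cal O}$ in which every conjunction $\bigwedge_{i\in I}$ (at any nesting level) has finite index set $I$. -}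

module Defs where

open import Level using (0ℓ) renaming (suc to lsuc)
open import Data.Nat using (ℕ; zero; suc)
open import Data.Bool using (Bool; T)
open import Data.List using (List)
open import Data.List.Membership.Propositional using (_∈_)
open import Data.Product using (Σ; ∃; _×_; _,_; proj₁)
open import Data.Unit using (⊤)
open import Data.Empty using (⊥)
open import Relation.Nullary using (¬_)
open import Relation.Binary.PropositionalEquality using (_≡_)

record LTS : Set₁ where
  field
    State : Set
    Act   : Set
    _⟶[_]_ : State → Act → State → Set

open LTS public

Finite : Set → Set
Finite X = Σ (List X) λ xs → ∀ x → x ∈ xs

Infinite : Set → Set
Infinite X = ¬ Finite X

ImageFinite : LTS → Set
ImageFinite L = ∀ (s : State L) (a : Act L) →
  Σ (List (State L)) λ xs → ∀ s' → LTS._⟶[_]_ L s a s' → s' ∈ xs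

data HML (A : Set) : Set₁ where
  𝐓   : HML A
  ⋀   : (I : Set) → (I → HML A) → HML A
  ⟨_⟩_ : A → HML A → HML A
  ∼_  : HML A → HML A

_⊨_ : {L : LTS} → State L → HML (Act L) → Set
_⊨_ {L} s 𝐓 = ⊤
_⊨_ {L} s (⋀ I φ) = ∀ i → _⊨_ {L} s (φ i)
_⊨_ {L} s (⟨ a ⟩ φ) = Σ (State L) λ s' → LTS._⟶[_]_ L s a s' × _⊨_ {L} s' φ
_⊨_ {L} s (∼ φ) = ¬ (_⊨_ {L} s φ)

-- depth:  DepthLe φ n  ⇔  d(φ) ≤ n   (d as in the paper, values in ℕ ∪ {∞})
DepthLe : {A : Set} → HML A → ℕ → Set
DepthLe 𝐓 n = ⊤
DepthLe (⋀ I φ) n = ∀ i → DepthLe (φ i) n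
DepthLe (⟨ a ⟩ φ) zero = ⊥
DepthLe (⟨ a ⟩ φ) (suc n) = DepthLe φ n
DepthLe (∼ φ) n = DepthLe φ n

FiniteDepth : {A : Set} → HML A → Set
FiniteDepth φ = Σ ℕ λ n → DepthLe φ n

InfiniteDepth : {A : Set} → HML A → Set
InfiniteDepth φ = ¬ FiniteDepth φ

AllConjFinite : {A : Set} → HML A → Set
AllConjFinite 𝐓 = ⊤
AllConjFinite (⋀ I φ) = Finite I × (∀ i → AllConjFinite (φ i))
AllConjFinite (⟨ a ⟩ φ) = AllConjFinite φ
AllConjFinite (∼ φ) = AllConjFinite φ

-- Contexts: formulas with exactly one hole.
-- conj I i₀ φ D  is the conjunction indexed by I whose i₀-th conjunct is
-- the context D and whose i-th conjunct (i ≢ i₀) is φ i  (φ i₀ is ignored).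

data Ctx (A : Set) : Set₁ where
  hole : Ctx A
  conj : (I : Set) → I → (I → HML A) → Ctx A → Ctx A
  dia  : A → Ctx A → Ctx A
  neg  : Ctx A → Ctx A

-- Plug D ψ χ  means  χ = D[ψ]
data Plug {A : Set} : Ctx A → HML A → HML A → Set₁ where
  plug-hole : ∀ {ψ} → Plug hole ψ ψ
  plug-conj : ∀ {I i₀ φ D ψ} (φ' : I → HML A) →
              Plug D ψ (φ' i₀) →
              (∀ i → ¬ (i ≡ i₀) → φ' i ≡ φ i) →
              Plug (conj I i₀ φ D) ψ (⋀ I φ')
  plug-dia  : ∀ {a D ψ χ} → Plug D ψ χ → Plug (dia a D) ψ (⟨ a ⟩ χ)
  plug-neg  : ∀ {D ψ χ} → Plug D ψ χ → Plug (neg D) ψ (∼ χ)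

FinSubset : Set → Set
FinSubset I = Σ (I → Bool) λ J → Σ (List I) λ xs → ∀ i → T (J i) → i ∈ xs

⋀sub : {A I : Set} → (I → HML A) → (I → Bool) → HML A
⋀sub {I = I} φ J = ⋀ (Σ I λ i → T (J i)) λ p → φ (proj₁ p)

FormSet : Set → Set₁
FormSet A = HML A → Set

Equiv : (L : LTS) → FormSet (Act L) → State L → State L → Set₁
Equiv L O s s' = ∀ φ → O φ → (_⊨_ {L} s φ → _⊨_ {L} s' φ) × (_⊨_ {L} s' φ → _⊨_ {L} s φ)

FDP : {A : Set} → FormSet A → FormSet A
FDP O φ = O φ × FiniteDepth φ

FIN : {A : Set} → FormSet A → FormSet A
FIN O φ = O φ × AllConjFinite φ

SameRel : {X : Set} → (X → X → Set₁) → (X → X → Set₁) → Set₁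
SameRel R R' = ∀ x y → (R x y → R' x y) × (R' x y → R x y)

Closed1 : {A : Set} → FormSet A → Set₁
Closed1 {A} O = ∀ (D : Ctx A) (I : Set) (φ : I → HML A) (χ : HML A) →
  Plug D (⋀ I φ) χ → O χ → Infinite I → InfiniteDepth (⋀ I φ) →
  ∀ (J : FinSubset I) (χ' : HML A) → Plug D (⋀sub φ (proj₁ J)) χ' → O χ'

Closed2 : {A : Set} → FormSet A → Set₁
Closed2 {A} O = ∀ (D : Ctx A) (I : Set) (φ : I → HML A) (χ : HML A) →
  Plug D (⋀ I φ) χ → O χ → Infinite I →
  ∀ (J : FinSubset I) (χ' : HML A) → Plug D (⋀sub φ (proj₁ J)) χ' → O χ'

module Submission where

-- A *truncation step* χ ↝ χ' replaces, inside a
-- context D, a conjunction ⋀_{i∈I} φᵢ satisfying a side condition (for (1):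
-- I infinite and the conjunction of infinite depth; for (2): I infinite) by
-- a finite sub-conjunction ⋀_{i∈J} φᵢ.  The hypotheses Closed1/Closed2 say
-- exactly that O is closed under such steps.
--
-- Key lemma (approximation): for every formula ψ and every finite list ts of
-- states there is ψ' with ψ ↝* ψ', ψ' in the target fragment (finite depth,
-- resp. only finite conjunctions) and ψ, ψ' satisfied by the same states of
-- ts.  It is proved by induction on ψ: for ⟨a⟩ψ one recurses on the finitely
-- many a-successors of ts (image-finiteness); a conjunction that has to be
-- truncated keeps, for each state of ts refuting it, one refuting conjunct;
-- a finite conjunction is approximated conjunct by conjunct.
--
-- The theorem follows: if x ∼_{O ∩ fragment} y and φ ∈ O, the approximant of
-- φ on [x, y] lies in O ∩ fragment and decides φ at x and y alike.  The
-- argument is classical and is developed once for an abstract fragment, then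
-- instantiated twice.

open import Defs
open import Level using (0ℓ) renaming (suc to lsuc)
open import Axiom.ExcludedMiddle using (ExcludedMiddle)
open import Axiom.DoubleNegationElimination using (em⇒dne)
open import Data.Bool using (Bool; T)
open import Data.Bool.Properties using (T-irrelevant)
open import Data.Empty using (⊥-elim)
open import Data.List using (List; []; _∷_; concatMap)
open import Data.List.Membership.Propositional using (_∈_; lose)
open import Data.List.Membership.Propositional.Properties using (∈-concatMap⁺)
open import Data.List.Relation.Unary.Any using (here; there)
open import Data.Nat using (ℕ; suc; _≤_; _⊔_; s≤s)
open import Data.Nat.Properties using (m≤m⊔n; m≤n⊔m)
open import Data.Product using (Σ; ∃; _×_; _,_; proj₁; proj₂)
open import Data.Sum using (_⊎_; inj₁; inj₂)
open import Data.Unit using (tt)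
open import Function using (_∘_; id)
open import Function.Bundles using (_⇔_; mk⇔; Equivalence)
open import Function.Properties.Equivalence using (⇔-isEquivalence)
open import Relation.Binary.Construct.Closure.ReflexiveTransitive using (Star; ε; _◅_; _◅◅_; gmap)
open import Relation.Binary.PropositionalEquality using (_≡_; _≢_; refl; sym; trans; subst; cong)
open import Relation.Binary.Structures using (IsEquivalence)
open import Relation.Nullary using (¬_; Dec; yes; no)
open import Relation.Nullary.Decidable using (isYes; T?; toWitness; fromWitness)

module ⇔ = IsEquivalence (⇔-isEquivalence {ℓ = 0ℓ})
open Equivalence using (to; from)

depthLe-mono : ∀ {A} (ψ : HML A) {m n} → DepthLe ψ m → m ≤ n → DepthLe ψ n
depthLe-mono 𝐓 _ _ = tt
depthLe-mono (⋀ I φ) d m≤n = λ i → depthLe-mono (φ i) (d i) m≤n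
depthLe-mono (⟨ a ⟩ ψ) {suc m} {suc n} d (s≤s m≤n) = depthLe-mono ψ d m≤n
depthLe-mono (∼ ψ) d m≤n = depthLe-mono ψ d m≤n

commonDepthBound : ∀ {A K : Set} (c : K → HML A) → (∀ k → FiniteDepth (c k)) →
  (ks : List K) → Σ ℕ λ n → ∀ {k} → k ∈ ks → DepthLe (c k) n
commonDepthBound c fd [] = 0 , λ ()
commonDepthBound c fd (k ∷ ks) with fd k | commonDepthBound c fd ks
... | m , dₖ | n , dₖₛ = m ⊔ n , bound
  where
  bound : ∀ {k'} → k' ∈ k ∷ ks → DepthLe (c k') (m ⊔ n)
  bound (here refl) = depthLe-mono (c k) dₖ (m≤m⊔n m n)
  bound (there k'∈ks) = depthLe-mono (c _) (dₖₛ k'∈ks) (m≤n⊔m m n)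

finiteDepth-⋀ : ∀ {A K : Set} → Finite K → (c : K → HML A) →
  (∀ k → FiniteDepth (c k)) → FiniteDepth (⋀ K c)
finiteDepth-⋀ (ks , ks-complete) c fd with commonDepthBound c fd ks
... | n , bound = n , λ k → bound (ks-complete k)

module _ {I : Set} (J : I → Bool) where

  private
    Members : Set
    Members = Σ I (T ∘ J)

    consIfMember : ∀ i → Dec (T (J i)) → List Members → List Members
    consIfMember i (yes i∈J) ms = (i , i∈J) ∷ ms
    consIfMember i (no _) ms = ms

    members : List I → List Members
    members [] = []
    members (i ∷ is) = consIfMember i (T? (J i)) (members is)

    members-complete : ∀ is i (i∈J : T (J i)) → i ∈ is → (i , i∈J) ∈ members is
    members-complete (i ∷ is) .i i∈J (here refl) with T? (J i)
    ... | yes i∈J' = here (cong (i ,_) (T-irrelevant i∈J i∈J'))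
    ... | no i∉J = ⊥-elim (i∉J i∈J)
    members-complete (j ∷ is) i i∈J (there i∈is) with T? (J j)
    ... | yes _ = there (members-complete is i i∈J i∈is)
    ... | no _ = members-complete is i i∈J i∈is

  finSubset-finite : (xs : List I) → (∀ i → T (J i) → i ∈ xs) → Finite (Σ I (T ∘ J))
  finSubset-finite xs covers =
    members xs , λ { (i , i∈J) → members-complete xs i i∈J (covers i i∈J) }

module Classical (em : ExcludedMiddle 0ℓ) where

  ¬∀⇒∃¬ : {I : Set} {P : I → Set} → ¬ (∀ i → P i) → ∃ λ i → ¬ P i
  ¬∀⇒∃¬ {I} {P} ¬∀ with em {∃ λ i → ¬ P i}
  ... | yes counterexample = counterexample
  ... | no none = ⊥-elim (¬∀ λ i → em⇒dne em λ ¬Pi → none (i , ¬Pi))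

  -- For a relation Q and finitely many t, finitely many indices suffice to
  -- test ∀ i. Q t i: collect one counterexample for each t where it fails.
  finiteTestSet : {S I : Set} (Q : S → I → Set) (ts : List S) →
    Σ (List I) λ xs → ∀ {t} → t ∈ ts → (∀ {i} → i ∈ xs → Q t i) → ∀ i → Q t i
  finiteTestSet Q [] = [] , λ ()
  finiteTestSet Q (t ∷ ts) with finiteTestSet Q ts | em {∀ i → Q t i}
  ... | xs , tests | yes all = xs , λ
    { (here refl) _ → all
    ; (there t∈ts) passes → tests t∈ts passes }
  ... | xs , tests | no ¬all with ¬∀⇒∃¬ ¬all
  ...   | i , ¬Qti = i ∷ xs , λ
    { (here refl) passes → ⊥-elim (¬Qti (passes (here refl)))
    ; (there t∈ts) passes → tests t∈ts (passes ∘ there) }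

  _[_≔_] : {K : Set} {X : Set₁} → (K → X) → K → X → K → X
  (g [ k₀ ≔ x ]) k with em {k ≡ k₀}
  ... | yes _ = x
  ... | no _ = g k

  update-at : {K : Set} {X : Set₁} (g : K → X) (k₀ : K) (x : X) → (g [ k₀ ≔ x ]) k₀ ≡ x
  update-at g k₀ x with em {k₀ ≡ k₀}
  ... | yes _ = refl
  ... | no k₀≢k₀ = ⊥-elim (k₀≢k₀ refl)

  update-off : {K : Set} {X : Set₁} (g : K → X) {k₀ k : K} (x : X) → k ≢ k₀ →
    (g [ k₀ ≔ x ]) k ≡ g k
  update-off g {k₀} {k} x k≢k₀ with em {k ≡ k₀}
  ... | yes k≡k₀ = ⊥-elim (k≢k₀ k≡k₀)
  ... | no _ = refl

module Truncation {A : Set} (Cond : (I : Set) → (I → HML A) → Set) where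

  infix 4 _↝_ _↝*_

  data _↝_ : HML A → HML A → Set₁ where
    truncate : ∀ (D : Ctx A) {I} {φ : I → HML A} {χ χ'} →
      Plug D (⋀ I φ) χ → Cond I φ →
      (J : FinSubset I) → Plug D (⋀sub φ (proj₁ J)) χ' → χ ↝ χ'

  _↝*_ : HML A → HML A → Set₁
  _↝*_ = Star _↝_

  ↝*-closed : (O : FormSet A) → (∀ {χ χ'} → χ ↝ χ' → O χ → O χ') →
    ∀ {χ χ'} → χ ↝* χ' → O χ → O χ'
  ↝*-closed O closed ε Oχ = Oχ
  ↝*-closed O closed (step ◅ steps) Oχ = ↝*-closed O closed steps (closed step Oχ)

  ↝*-⟨⟩ : ∀ a {ψ ψ'} → ψ ↝* ψ' → ⟨ a ⟩ ψ ↝* ⟨ a ⟩ ψ'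
  ↝*-⟨⟩ a = gmap (⟨ a ⟩_) λ where
    (truncate D p c J p') → truncate (dia a D) (plug-dia p) c J (plug-dia p')

  ↝*-∼ : ∀ {ψ ψ'} → ψ ↝* ψ' → ∼ ψ ↝* ∼ ψ'
  ↝*-∼ = gmap ∼_ λ where
    (truncate D p c J p') → truncate (neg D) (plug-neg p) c J (plug-neg p')

  module _ (em : ExcludedMiddle 0ℓ) where
    open Classical em using (_[_≔_]; update-at; update-off)

    ↝*-⋀ : ∀ {K : Set} (g : K → HML A) (k₀ : K) {ψ ψ'} → g k₀ ≡ ψ → ψ ↝* ψ' →
      Σ (K → HML A) λ h → ⋀ K g ↝* ⋀ K h × h k₀ ≡ ψ' × (∀ k → k ≢ k₀ → h k ≡ g k)
    ↝*-⋀ g k₀ gk₀≡ψ ε = g , ε , gk₀≡ψ , λ _ _ → refl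
    ↝*-⋀ {K} g k₀ gk₀≡ψ (truncate D {χ' = χ₁} p c J p' ◅ steps)
      with ↝*-⋀ (g [ k₀ ≔ χ₁ ]) k₀ (update-at g k₀ χ₁) steps
    ... | h , g₁↝*h , at , off =
      h , firstStep ◅ g₁↝*h , at , λ k k≢k₀ → trans (off k k≢k₀) (update-off g χ₁ k≢k₀)
      where
      firstStep : ⋀ K g ↝ ⋀ K (g [ k₀ ≔ χ₁ ])
      firstStep = truncate (conj K k₀ g D) (plug-conj g (subst (Plug D _) (sym gk₀≡ψ) p)
          λ _ _ → refl) c J
        (plug-conj (g [ k₀ ≔ χ₁ ]) (subst (Plug D _) (sym (update-at g k₀ χ₁)) p')
          λ k k≢k₀ → update-off g χ₁ k≢k₀)

module Semantics (L : LTS) where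

  infix 4 _⊨ᴸ_
  _⊨ᴸ_ : State L → HML (Act L) → Set
  t ⊨ᴸ ψ = _⊨_ {L} t ψ

  ⟨⟩-cong : ∀ {t} a {ψ ψ'} → (∀ {u} → LTS._⟶[_]_ L t a u → u ⊨ᴸ ψ ⇔ u ⊨ᴸ ψ') →
    t ⊨ᴸ ⟨ a ⟩ ψ ⇔ t ⊨ᴸ ⟨ a ⟩ ψ'
  ⟨⟩-cong a same = mk⇔
    (λ { (u , t⟶u , u⊨ψ) → u , t⟶u , to (same t⟶u) u⊨ψ })
    (λ { (u , t⟶u , u⊨ψ') → u , t⟶u , from (same t⟶u) u⊨ψ' })

  ∼-cong : ∀ {t ψ ψ'} → t ⊨ᴸ ψ ⇔ t ⊨ᴸ ψ' → t ⊨ᴸ ∼ ψ ⇔ t ⊨ᴸ ∼ ψ'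
  ∼-cong same = mk⇔ (λ t⊭ψ → t⊭ψ ∘ from same) (λ t⊭ψ' → t⊭ψ' ∘ to same)

  ⊨-≡ : ∀ {t ψ ψ'} → ψ ≡ ψ' → t ⊨ᴸ ψ ⇔ t ⊨ᴸ ψ'
  ⊨-≡ refl = ⇔.refl

  ⋀-cong : ∀ {t K} {c d : K → HML (Act L)} → (∀ k → t ⊨ᴸ c k ⇔ t ⊨ᴸ d k) →
    t ⊨ᴸ ⋀ K c ⇔ t ⊨ᴸ ⋀ K d
  ⋀-cong same = mk⇔ (λ t⊨c k → to (same k) (t⊨c k)) (λ t⊨d k → from (same k) (t⊨d k))

record Fragment (A : Set) : Set₁ where
  field
    Good : HML A → Set
    Cond : (I : Set) → (I → HML A) → Set
    good-𝐓 : Good 𝐓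
    good-⟨⟩ : ∀ a {ψ} → Good ψ → Good (⟨ a ⟩ ψ)
    good-∼ : ∀ {ψ} → Good ψ → Good (∼ ψ)
    good-⋀ : ∀ {K} → Finite K → (c : K → HML A) → (∀ k → Good (c k)) → Good (⋀ K c)
    classify : ∀ I (φ : I → HML A) → Good (⋀ I φ) ⊎ Finite I ⊎ Cond I φ

module Approximation (em : ExcludedMiddle 0ℓ) (L : LTS) (imf : ImageFinite L)
                     (𝓕 : Fragment (Act L)) where
  open Fragment 𝓕
  open Semantics L
  open Truncation Cond

  private
    F : Set₁
    F = HML (Act L)
    S : Set
    S = State L

  AgreeOn : List S → F → F → Set
  AgreeOn ts ψ ψ' = ∀ {t} → t ∈ ts → t ⊨ᴸ ψ ⇔ t ⊨ᴸ ψ'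

  record Approximant (ts : List S) (ψ : F) : Set₁ where
    field
      formula : F
      steps : ψ ↝* formula
      good : Good formula
      agree : AgreeOn ts ψ formula
  open Approximant

  approx-good : ∀ {ts ψ} → Good ψ → Approximant ts ψ
  approx-good {ψ = ψ} goodψ = record
    { formula = ψ ; steps = ε ; good = goodψ ; agree = λ _ → ⇔.refl }

  successors : Act L → List S → List S
  successors a = concatMap λ t → proj₁ (imf t a)

  successors-complete : ∀ {a ts t u} → t ∈ ts → LTS._⟶[_]_ L t a u → u ∈ successors a ts
  successors-complete {a} {u = u} t∈ts t⟶u =
    ∈-concatMap⁺ _ (lose t∈ts (proj₂ (imf _ a) u t⟶u))

  approx-⟨⟩ : ∀ a {ts ψ} → Approximant (successors a ts) ψ → Approximant ts (⟨ a ⟩ ψ)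
  approx-⟨⟩ a r = record
    { formula = ⟨ a ⟩ formula r
    ; steps = ↝*-⟨⟩ a (steps r)
    ; good = good-⟨⟩ a (good r)
    ; agree = λ t∈ts → ⟨⟩-cong a λ t⟶u → agree r (successors-complete t∈ts t⟶u)
    }

  approx-∼ : ∀ {ts ψ} → Approximant ts ψ → Approximant ts (∼ ψ)
  approx-∼ r = record
    { formula = ∼ formula r
    ; steps = ↝*-∼ (steps r)
    ; good = good-∼ (good r)
    ; agree = λ t∈ts → ∼-cong (agree r t∈ts)
    }

  -- A finite conjunction ⋀_{k∈K} c_k is approximated conjunct by conjunct,
  -- running the truncations of each conjunct in turn along an enumeration
  -- of K; the conjunction keeps its index set K.
  module _ {K : Set} {ts : List S} (c : K → F) (r : ∀ k → Approximant ts (c k)) where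
    private
      target : K → F
      target k = formula (r k)

      -- Invariant while walking the enumeration: each conjunct of g is
      -- either finished or untouched and still pending.
      Status : (K → F) → List K → K → Set₁
      Status g pending k = g k ≡ target k ⊎ (g k ≡ c k × k ∈ pending)

      Pending : (K → F) → List K → Set₁
      Pending g pending = ∀ k → Status g pending k

      remainingSteps : ∀ {g pending} k → Status g pending k →
        Σ F λ ψ → g k ≡ ψ × ψ ↝* target k
      remainingSteps k (inj₁ finished) = target k , finished , ε
      remainingSteps k (inj₂ (untouched , _)) = c k , untouched , steps (r k)

      pending-next : ∀ {g h k₀ pending} → Pending g (k₀ ∷ pending) →
        h k₀ ≡ target k₀ → (∀ k → k ≢ k₀ → h k ≡ g k) → Pending h pending
      pending-next {k₀ = k₀} pend at off k with em {k ≡ k₀}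
      ... | yes refl = inj₁ at
      ... | no k≢k₀ with pend k
      ...   | inj₁ finished = inj₁ (trans (off k k≢k₀) finished)
      ...   | inj₂ (_ , here k≡k₀) = ⊥-elim (k≢k₀ k≡k₀)
      ...   | inj₂ (untouched , there k∈pending) =
        inj₂ (trans (off k k≢k₀) untouched , k∈pending)

      process : ∀ pending g → Pending g pending →
        Σ (K → F) λ h → ⋀ K g ↝* ⋀ K h × (∀ k → h k ≡ target k)
      process [] g pend = g , ε , λ k → finished (pend k)
        where
        finished : ∀ {k} → Status g [] k → g k ≡ target k
        finished (inj₁ done) = done
        finished (inj₂ (_ , ()))
      process (k₀ ∷ pending) g pend with remainingSteps {g = g} k₀ (pend k₀)
      ... | ψ , gk₀≡ψ , ψ↝*target with ↝*-⋀ em g k₀ gk₀≡ψ ψ↝*target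
      ... | h , g↝*h , at , off with process pending h (pending-next {g = g} pend at off)
      ... | h' , h↝*h' , final = h' , g↝*h ◅◅ h↝*h' , final

    approx-⋀-finite : Finite K → Approximant ts (⋀ K c)
    approx-⋀-finite (ks , ks-complete)
      with process ks c (λ k → inj₂ (refl , ks-complete k))
    ... | h , c↝*h , final = record
      { formula = ⋀ K h
      ; steps = c↝*h
      ; good = good-⋀ (ks , ks-complete) h λ k → subst Good (sym (final k)) (good (r k))
      ; agree = λ t∈ts → ⋀-cong λ k → ⇔.trans (agree (r k) t∈ts) (⊨-≡ (sym (final k)))
      }

  -- A conjunction ⋀_{i∈I} φᵢ with Cond I φ is truncated to the finite set J
  -- of conjuncts needed to refute it at those states of ts where it fails;
  -- then the finite conjunction is approximated.
  approx-⋀-truncate : ∀ {I ts} (φ : I → F) → Cond I φ →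
    (∀ i → Approximant ts (φ i)) → Approximant ts (⋀ I φ)
  approx-⋀-truncate {I} {ts} φ cond r = record
    { formula = formula sub
    ; steps = truncate hole plug-hole cond J plug-hole ◅ steps sub
    ; good = good sub
    ; agree = λ t∈ts → ⇔.trans (truncation-sound t∈ts) (agree sub t∈ts)
    }
    where
    tests : Σ (List I) λ xs → ∀ {t} → t ∈ ts → (∀ {i} → i ∈ xs → t ⊨ᴸ φ i) → ∀ i → t ⊨ᴸ φ i
    tests = Classical.finiteTestSet em (λ t i → t ⊨ᴸ φ i) ts

    inJ : I → Bool
    inJ i = isYes (em {i ∈ proj₁ tests})

    J : FinSubset I
    J = inJ , proj₁ tests , λ _ → toWitness

    sub : Approximant ts (⋀sub φ inJ)
    sub = approx-⋀-finite (φ ∘ proj₁) (r ∘ proj₁)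
      (finSubset-finite inJ (proj₁ tests) (λ _ → toWitness))

    truncation-sound : AgreeOn ts (⋀ I φ) (⋀sub φ inJ)
    truncation-sound t∈ts = mk⇔
      (λ t⊨⋀ j → t⊨⋀ (proj₁ j))
      (λ t⊨⋀J → proj₂ tests t∈ts λ {i} i∈xs → t⊨⋀J (i , fromWitness i∈xs))

  approx : ∀ ψ ts → Approximant ts ψ
  approx 𝐓 ts = approx-good good-𝐓
  approx (⟨ a ⟩ ψ) ts = approx-⟨⟩ a (approx ψ (successors a ts))
  approx (∼ ψ) ts = approx-∼ (approx ψ ts)
  approx (⋀ I φ) ts with classify I φ
  ... | inj₁ good⋀ = approx-good good⋀
  ... | inj₂ (inj₁ finite) = approx-⋀-finite φ (λ i → approx (φ i) ts) finite
  ... | inj₂ (inj₂ cond) = approx-⋀-truncate φ cond (λ i → approx (φ i) ts)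

  coincide : (O : FormSet (Act L)) → (∀ {χ χ'} → χ ↝ χ' → O χ → O χ') →
    SameRel (Equiv L O) (Equiv L (λ φ → O φ × Good φ))
  coincide O closed x y = (λ x∼y φ Oφ → x∼y φ (proj₁ Oφ)) , fromFragment
    where
    fromFragment : Equiv L (λ φ → O φ × Good φ) x y → Equiv L O x y
    fromFragment x∼y φ Oφ = to x⊨φ⇔y⊨φ , from x⊨φ⇔y⊨φ
      where
      r : Approximant (x ∷ y ∷ []) φ
      r = approx φ (x ∷ y ∷ [])

      r∈fragment : O (formula r) × Good (formula r)
      r∈fragment = ↝*-closed O closed (steps r) Oφ , good r

      x⊨r⇔y⊨r : x ⊨ᴸ formula r ⇔ y ⊨ᴸ formula r
      x⊨r⇔y⊨r = mk⇔ (proj₁ (x∼y _ r∈fragment)) (proj₂ (x∼y _ r∈fragment))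

      x⊨φ⇔y⊨φ : x ⊨ᴸ φ ⇔ y ⊨ᴸ φ
      x⊨φ⇔y⊨φ = ⇔.trans (agree r (here refl))
                  (⇔.trans x⊨r⇔y⊨r (⇔.sym (agree r (there (here refl)))))

InfiniteDeepConj : {A : Set} (I : Set) → (I → HML A) → Set
InfiniteDeepConj I φ = Infinite I × InfiniteDepth (⋀ I φ)

InfiniteConj : {A : Set} (I : Set) → (I → HML A) → Set
InfiniteConj I _ = Infinite I

closed1-truncation : {A : Set} (O : FormSet A) → Closed1 O →
  ∀ {χ χ'} → Truncation._↝_ InfiniteDeepConj χ χ' → O χ → O χ'
closed1-truncation O closed (Truncation.truncate D p (infinite , deep) J p') Oχ =
  closed D _ _ _ p Oχ infinite deep J _ p'

closed2-truncation : {A : Set} (O : FormSet A) → Closed2 O →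
  ∀ {χ χ'} → Truncation._↝_ InfiniteConj χ χ' → O χ → O χ'
closed2-truncation O closed (Truncation.truncate D p infinite J p') Oχ =
  closed D _ _ _ p Oχ infinite J _ p'

finiteDepthFragment : ExcludedMiddle 0ℓ → (A : Set) → Fragment A
finiteDepthFragment em A = record
  { Good = FiniteDepth
  ; Cond = InfiniteDeepConj
  ; good-𝐓 = 0 , tt
  ; good-⟨⟩ = λ { _ (n , depth≤n) → suc n , depth≤n }
  ; good-∼ = id
  ; good-⋀ = finiteDepth-⋀
  ; classify = classify
  }
  where
  classify : ∀ I (φ : I → HML A) →
    FiniteDepth (⋀ I φ) ⊎ Finite I ⊎ InfiniteDeepConj I φ
  classify I φ with em {FiniteDepth (⋀ I φ)} | em {Finite I}
  ... | yes shallow | _ = inj₁ shallow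
  ... | no _ | yes finite = inj₂ (inj₁ finite)
  ... | no deep | no infinite = inj₂ (inj₂ (infinite , deep))

finiteConjFragment : ExcludedMiddle 0ℓ → (A : Set) → Fragment A
finiteConjFragment em A = record
  { Good = AllConjFinite
  ; Cond = InfiniteConj
  ; good-𝐓 = tt
  ; good-⟨⟩ = λ _ → id
  ; good-∼ = id
  ; good-⋀ = λ finite _ good → finite , good
  ; classify = classify
  }
  where
  classify : ∀ I (φ : I → HML A) →
    AllConjFinite (⋀ I φ) ⊎ Finite I ⊎ InfiniteConj I φ
  classify I φ with em {Finite I}
  ... | yes finite = inj₂ (inj₁ finite)
  ... | no infinite = inj₂ (inj₂ infinite)

theorem5 : ExcludedMiddle 0ℓ → ExcludedMiddle (lsuc 0ℓ) →
    (L : LTS) → ImageFinite L → (O : FormSet (Act L)) →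
    (Closed1 O → SameRel (Equiv L O) (Equiv L (FDP O)))
    × (Closed2 O → SameRel (Equiv L O) (Equiv L (FIN O)))
theorem5 em _ L imf O =
  (λ closed → Approximation.coincide em L imf (finiteDepthFragment em (Act L)) O
                (closed1-truncation O closed)) ,
  (λ closed → Approximation.coincide em L imf (finiteConjFragment em (Act L)) O
                (closed2-truncation O closed))
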